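{- In $\mathsf{CNOT}$, for $n,m,p\in\mathbb{N}$: (i) if $f:n\to m$ satisfies $f=f\otimes\Omega$, then $f=\Omega_{n,m}$; (ii) if $g:m\to p$, then $\Omega_{n,m}g=\Omega_{n,p}$; (iii) if $h:p\to n$, then $h\,\Omega_{n,m}=\Omega_{p,m}$.
   Context: $\mathsf{CNOT}$ is the strict symmetric monoidal category with objects the natural numbers ($n\otimes m=n+m$) generated by $\mathsf{cnot}:2\to2$, $|1\rangle:0\to1$, $\langle1|:1\to0$ (and symmetry $\sigma$) modulo exactly the following identities (diagrammatic composition, $fg$ = first $f$ then $g$; $C_{i\to j}$ the cnot with control wire $i$, target wire $j$; $\mathsf{cnot}=C_{1\to2}$): $C_{1\to2}C_{2\to1}C_{1\to2}=\sigma$; $C_{1\to2}C_{1\to2}=1_2$; $C_{2\to1}C_{2\to3}=C_{2\to3}C_{2\to1}$; $(|1\rangle\otimes1)C_{1\to2}=(|1\rangle\otimes1)C_{1\to2}(\langle1|\otimes1)(|1\rangle\otimes1)$ and $C_{1\to2}(\langle1|\otimes1)=(\langle1|\otimes1)(|1\rangle\otimes1)C_{1\to2}(\langle1|\otimes1)$; $C_{1\to2}C_{3\to2}=C_{3\to2}C_{1\to2}$; $|1\rangle\langle1|=1_0$; $(|1\rangle\otimes|1\rangle\otimes1)C_{1\to2}C_{2\to3}(\langle1|\otimes1_2)=(|1\rangle\otimes|1\rangle\otimes1)C_{1\to2}(\langle1|\otimes1_2)$ and $(|1\rangle\otimes1_2)C_{2\to3}C_{1\to2}(\langle1|\otimes\langle1|\otimes1)=(|1\rangle\otimes1_2)C_{1\to2}(\langle1|\otimes\langle1|\otimes1)$;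 $C_{1\to2}C_{2\to3}C_{1\to2}=C_{2\to3}C_{1\to3}$; $(|1\rangle\otimes|1\rangle\otimes1)C_{1\to2}(\langle1|\otimes\langle1|\otimes1)=(|1\rangle\otimes|1\rangle\otimes\langle1|)C_{1\to2}(\langle1|\otimes\langle1|\otimes|1\rangle)$. $\Omega:=(|1\rangle\otimes|1\rangle)\,\mathsf{cnot}\,(\langle1|\otimes\langle1|):0\to0$, and $\Omega_{n,m}:=(\otimes^n\langle1|)\,\Omega\,(\otimes^m|1\rangle):n\to m$, where $\otimes^k$ is the $k$-fold tensor power. -}

module Defs where

open import Data.Nat using (ℕ; zero; suc; _+_)
open import Data.Nat.Properties using (+-assoc)
open import Relation.Binary.PropositionalEquality using (_≡_; refl; sym)

-- Syntax of morphisms of a PROP (strict symmetric monoidal category with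
-- objects ℕ, n ⊗ m = n + m) generated by cnot : 2 → 2, ket = |1⟩ : 0 → 1,
-- bra = ⟨1| : 1 → 0, and symmetries.
-- Composition is diagrammatic: f ⨾ g = first f then g.
infixr 6 _⊗_
infixr 5 _⨾_

data Tm : ℕ → ℕ → Set where
  id   : (a : ℕ) → Tm a a
  _⨾_  : ∀ {a b c} → Tm a b → Tm b c → Tm a c
  _⊗_  : ∀ {a b c d} → Tm a b → Tm c d → Tm (a + c) (b + d)
  sw   : (a b : ℕ) → Tm (a + b) (b + a)
  cnot : Tm 2 2
  ket  : Tm 0 1
  bra  : Tm 1 0

cast : ∀ {a b a' b'} → a ≡ a' → b ≡ b' → Tm a b → Tm a' b'
cast refl refl f = f

σ : Tm 2 2
σ = sw 1 1

-- cnots with control i and target j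
C12 : Tm 2 2
C12 = cnot

C21 : Tm 2 2
C21 = σ ⨾ cnot ⨾ σ

C12₃ : Tm 3 3
C12₃ = cnot ⊗ id 1

C21₃ : Tm 3 3
C21₃ = C21 ⊗ id 1

C23₃ : Tm 3 3
C23₃ = id 1 ⊗ cnot

C32₃ : Tm 3 3
C32₃ = id 1 ⊗ C21

C13₃ : Tm 3 3
C13₃ = (id 1 ⊗ σ) ⨾ (cnot ⊗ id 1) ⨾ (id 1 ⊗ σ)

data Ax : ∀ {a b} → Tm a b → Tm a b → Set where
  ax1  : Ax (C12 ⨾ C21 ⨾ C12) σ
  ax2  : Ax (C12 ⨾ C12) (id 2)
  ax3  : Ax (C21₃ ⨾ C23₃) (C23₃ ⨾ C21₃)
  ax4  : Ax ((ket ⊗ id 1) ⨾ C12)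
            ((ket ⊗ id 1) ⨾ C12 ⨾ (bra ⊗ id 1) ⨾ (ket ⊗ id 1))
  ax5  : Ax (C12 ⨾ (bra ⊗ id 1))
            ((bra ⊗ id 1) ⨾ (ket ⊗ id 1) ⨾ C12 ⨾ (bra ⊗ id 1))
  ax6  : Ax (C12₃ ⨾ C32₃) (C32₃ ⨾ C12₃)
  ax7  : Ax (ket ⨾ bra) (id 0)
  ax8  : Ax ((ket ⊗ ket ⊗ id 1) ⨾ C12₃ ⨾ C23₃ ⨾ (bra ⊗ id 2))
            ((ket ⊗ ket ⊗ id 1) ⨾ C12₃ ⨾ (bra ⊗ id 2))
  ax9  : Ax ((ket ⊗ id 2) ⨾ C23₃ ⨾ C12₃ ⨾ (bra ⊗ bra ⊗ id 1))
            ((ket ⊗ id 2) ⨾ C12₃ ⨾ (bra ⊗ bra ⊗ id 1))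
  ax10 : Ax (C12₃ ⨾ C23₃ ⨾ C12₃) (C23₃ ⨾ C13₃)
  ax11 : Ax ((ket ⊗ ket ⊗ id 1) ⨾ C12₃ ⨾ (bra ⊗ bra ⊗ id 1))
            ((ket ⊗ ket ⊗ bra) ⨾ C12 ⨾ (bra ⊗ bra ⊗ ket))

-- It is stated
-- heterogeneously in the indices, so that strictness equations whose two
-- sides have only propositionally equal types (e.g. associativity of ⊗,
-- f ⊗ id 0 = f) can be written directly; every generating equation relates
-- terms whose types agree up to ≡.
infix 4 _≈_
data _≈_ : ∀ {a b c d} → Tm a b → Tm c d → Set where
  ≈-refl  : ∀ {a b} {f : Tm a b} → f ≈ f
  ≈-sym   : ∀ {a b c d} {f : Tm a b} {g : Tm c d} → f ≈ g → g ≈ f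
  ≈-trans : ∀ {a b c d e k} {f : Tm a b} {g : Tm c d} {h : Tm e k} →
            f ≈ g → g ≈ h → f ≈ h
  ⨾-cong  : ∀ {a b c a' b' c'} {f : Tm a b} {g : Tm b c}
              {f' : Tm a' b'} {g' : Tm b' c'} →
            f ≈ f' → g ≈ g' → (f ⨾ g) ≈ (f' ⨾ g')
  ⊗-cong  : ∀ {a b c d a' b' c' d'} {f : Tm a b} {g : Tm c d}
              {f' : Tm a' b'} {g' : Tm c' d'} →
            f ≈ f' → g ≈ g' → (f ⊗ g) ≈ (f' ⊗ g')
  idˡ     : ∀ {a b} (f : Tm a b) → (id a ⨾ f) ≈ f
  idʳ     : ∀ {a b} (f : Tm a b) → (f ⨾ id b) ≈ f
  ⨾-assoc : ∀ {a b c d} (f : Tm a b) (g : Tm b c) (h : Tm c d) →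
            ((f ⨾ g) ⨾ h) ≈ (f ⨾ (g ⨾ h))
  ⊗-id    : (a b : ℕ) → (id a ⊗ id b) ≈ id (a + b)
  interchange : ∀ {a b c a' b' c'} (f : Tm a b) (g : Tm b c)
                  (f' : Tm a' b') (g' : Tm b' c') →
                ((f ⨾ g) ⊗ (f' ⨾ g')) ≈ ((f ⊗ f') ⨾ (g ⊗ g'))
  ⊗-assoc : ∀ {a b c d e k} (f : Tm a b) (g : Tm c d) (h : Tm e k) →
            ((f ⊗ g) ⊗ h) ≈ (f ⊗ (g ⊗ h))
  ⊗-unitˡ : ∀ {a b} (f : Tm a b) → (id 0 ⊗ f) ≈ f
  ⊗-unitʳ : ∀ {a b} (f : Tm a b) → (f ⊗ id 0) ≈ f
  sw-inv  : (a b : ℕ) → (sw a b ⨾ sw b a) ≈ id (a + b)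
  sw-nat  : ∀ {a b c d} (f : Tm a c) (g : Tm b d) →
            ((f ⊗ g) ⨾ sw c d) ≈ (sw a b ⨾ (g ⊗ f))
  sw-hexˡ : (a b c : ℕ) → sw a (b + c) ≈
            ((sw a b ⊗ id c) ⨾ cast (sym (+-assoc b a c)) refl (id b ⊗ sw a c))
  sw-hexʳ : (a b c : ℕ) → sw (a + b) c ≈
            ((id a ⊗ sw b c) ⨾ cast (+-assoc a c b) refl (sw a c ⊗ id b))
  sw-unitˡ : (a : ℕ) → sw 0 a ≈ id a
  sw-unitʳ : (a : ℕ) → sw a 0 ≈ id a
  ax      : ∀ {a b} {f g : Tm a b} → Ax f g → f ≈ g

Ω : Tm 0 0
Ω = (ket ⊗ ket) ⨾ cnot ⨾ (bra ⊗ bra)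

bras : (k : ℕ) → Tm k 0
bras zero    = id 0
bras (suc k) = bra ⊗ bras k

kets : (k : ℕ) → Tm 0 k
kets zero    = id 0
kets (suc k) = ket ⊗ kets k

Ω[_,_] : (n m : ℕ) → Tm n m
Ω[ n , m ] = bras n ⨾ Ω ⨾ kets m

module Submission where

-- Ω = ⟨11| cnot |11⟩ is the inner product ⟨1|0⟩, where |0⟩ := NOT |1⟩ is |1⟩
-- sent through cnot with control |1⟩; so Ω behaves as the zero scalar.  It
-- is idempotent (Ω ⊗ Ω = Ω, since cnot fixes |00⟩ and ⟨11| cnot = ⟨1| ⊗ ⟨0|),
-- and Ω ⊗ g = Ω_{a,b} for every generator g : a → b (for cnot because
-- moreover ⟨0| Ω = ⟨1| Ω).  Since the Ω_{a,b} are closed under ⨾ and ⊗,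
-- induction on terms gives Ω ⊗ f = Ω_{a,b} for every f : a → b.  All three
-- claims follow, as Ω_{n,m} = Ω ⊗ Ω_{n,m} and scalars slide through
-- composition.

open import Defs
open import Data.Nat using (ℕ; zero; suc; _+_)
open import Data.Nat.Properties using (+-identityʳ)
open import Data.Product using (_×_; _,_)
open import Relation.Binary.PropositionalEquality using (_≡_; refl; sym)

infix  1 begin_
infixr 2 _≈⟨_⟩_
infix  3 _∎

begin_ : ∀ {a b c d} {f : Tm a b} {g : Tm c d} → f ≈ g → f ≈ g
begin p = p

_≈⟨_⟩_ : ∀ {a b c d e k} (f : Tm a b) {g : Tm c d} {h : Tm e k} →
         f ≈ g → g ≈ h → f ≈ h
f ≈⟨ p ⟩ q = ≈-trans p q

_∎ : ∀ {a b} (f : Tm a b) → f ≈ f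
f ∎ = ≈-refl

id-cong : ∀ {a a'} → a ≡ a' → id a ≈ id a'
id-cong refl = ≈-refl

⨾-assoc⁻¹ : ∀ {a b c d} (f : Tm a b) (g : Tm b c) (h : Tm c d) →
            (f ⨾ (g ⨾ h)) ≈ ((f ⨾ g) ⨾ h)
⨾-assoc⁻¹ f g h = ≈-sym (⨾-assoc f g h)

interchange₃ : ∀ {a b c d a' b' c' d'}
                 (f : Tm a b) (g : Tm b c) (h : Tm c d)
                 (f' : Tm a' b') (g' : Tm b' c') (h' : Tm c' d') →
               ((f ⨾ (g ⨾ h)) ⊗ (f' ⨾ (g' ⨾ h'))) ≈
               ((f ⊗ f') ⨾ ((g ⊗ g') ⨾ (h ⊗ h')))
interchange₃ f g h f' g' h' =
  ≈-trans (interchange f (g ⨾ h) f' (g' ⨾ h'))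
          (⨾-cong ≈-refl (interchange g h g' h'))

⊗-of-state : ∀ {b c d} (x : Tm 0 b) (g : Tm c d) → (x ⊗ g) ≈ (g ⨾ (x ⊗ id d))
⊗-of-state {d = d} x g = begin
  (x ⊗ g)                    ≈⟨ ⊗-cong (≈-sym (idˡ x)) (≈-sym (idʳ g)) ⟩
  ((id 0 ⨾ x) ⊗ (g ⨾ id d))  ≈⟨ interchange (id 0) x g (id d) ⟩
  ((id 0 ⊗ g) ⨾ (x ⊗ id d))  ≈⟨ ⨾-cong (⊗-unitˡ g) ≈-refl ⟩
  (g ⨾ (x ⊗ id d))           ∎

⊗-of-effect : ∀ {a c d} (x : Tm a 0) (g : Tm c d) → (x ⊗ g) ≈ ((x ⊗ id c) ⨾ g)
⊗-of-effect {c = c} x g = begin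
  (x ⊗ g)                    ≈⟨ ⊗-cong (≈-sym (idʳ x)) (≈-sym (idˡ g)) ⟩
  ((x ⨾ id 0) ⊗ (id c ⨾ g))  ≈⟨ interchange x (id 0) (id c) g ⟩
  ((x ⊗ id c) ⨾ (id 0 ⊗ g))  ≈⟨ ⨾-cong ≈-refl (⊗-unitˡ g) ⟩
  ((x ⊗ id c) ⨾ g)           ∎

scalar-⊗-effect : ∀ {a} (s : Tm 0 0) (x : Tm a 0) → (s ⊗ x) ≈ (x ⨾ s)
scalar-⊗-effect s x = ≈-trans (⊗-of-state s x) (⨾-cong ≈-refl (⊗-unitʳ s))

scalar-⊗-state : ∀ {b} (s : Tm 0 0) (y : Tm 0 b) → (s ⊗ y) ≈ (s ⨾ y)
scalar-⊗-state s y = ≈-trans (⊗-of-effect s y) (⨾-cong (⊗-unitʳ s) ≈-refl)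

scalar-⨾ˡ : ∀ {a b c} (s : Tm 0 0) (f : Tm a b) (g : Tm b c) →
            ((s ⊗ f) ⨾ g) ≈ (s ⊗ (f ⨾ g))
scalar-⨾ˡ s f g = begin
  ((s ⊗ f) ⨾ g)           ≈⟨ ⨾-cong ≈-refl (≈-sym (⊗-unitˡ g)) ⟩
  ((s ⊗ f) ⨾ (id 0 ⊗ g))  ≈⟨ ≈-sym (interchange s (id 0) f g) ⟩
  ((s ⨾ id 0) ⊗ (f ⨾ g))  ≈⟨ ⊗-cong (idʳ s) ≈-refl ⟩
  (s ⊗ (f ⨾ g))           ∎

scalar-⨾ʳ : ∀ {a b c} (s : Tm 0 0) (f : Tm a b) (g : Tm b c) →
            (f ⨾ (s ⊗ g)) ≈ (s ⊗ (f ⨾ g))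
scalar-⨾ʳ s f g = begin
  (f ⨾ (s ⊗ g))           ≈⟨ ⨾-cong (≈-sym (⊗-unitˡ f)) ≈-refl ⟩
  ((id 0 ⊗ f) ⨾ (s ⊗ g))  ≈⟨ ≈-sym (interchange (id 0) s f g) ⟩
  ((id 0 ⨾ s) ⊗ (f ⨾ g))  ≈⟨ ⊗-cong (idˡ s) ≈-refl ⟩
  (s ⊗ (f ⨾ g))           ∎

scalar-comm : ∀ {a b} (s : Tm 0 0) (f : Tm a b) → (f ⊗ s) ≈ (s ⊗ f)
scalar-comm {a} {b} s f = begin
  (f ⊗ s)                 ≈⟨ ≈-sym (idʳ _) ⟩
  ((f ⊗ s) ⨾ id (b + 0))  ≈⟨ ⨾-cong ≈-refl (≈-sym (≈-trans (sw-unitʳ b) (id-cong (sym (+-identityʳ b))))) ⟩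
  ((f ⊗ s) ⨾ sw b 0)      ≈⟨ sw-nat f s ⟩
  (sw a 0 ⨾ (s ⊗ f))      ≈⟨ ⨾-cong (sw-unitʳ a) ≈-refl ⟩
  (id a ⨾ (s ⊗ f))        ≈⟨ idˡ _ ⟩
  (s ⊗ f)                 ∎

-- With the control wire fixed to |1⟩, cnot acts on its target as NOT.
notGate : Tm 1 1
notGate = (ket ⊗ id 1) ⨾ (cnot ⨾ (bra ⊗ id 1))

ket0 : Tm 0 1
ket0 = (ket ⊗ ket) ⨾ (cnot ⨾ (bra ⊗ id 1))

ket0-via-not : ket0 ≈ (ket ⨾ notGate)
ket0-via-not = ≈-trans (⨾-cong (⊗-of-state ket ket) ≈-refl) (⨾-assoc _ _ _)

ket0-bra : (ket0 ⨾ bra) ≈ Ω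
ket0-bra = begin
  (((ket ⊗ ket) ⨾ (cnot ⨾ (bra ⊗ id 1))) ⨾ bra)  ≈⟨ ⨾-assoc _ _ _ ⟩
  ((ket ⊗ ket) ⨾ ((cnot ⨾ (bra ⊗ id 1)) ⨾ bra))  ≈⟨ ⨾-cong ≈-refl (⨾-assoc _ _ _) ⟩
  ((ket ⊗ ket) ⨾ (cnot ⨾ ((bra ⊗ id 1) ⨾ bra)))  ≈⟨ ⨾-cong ≈-refl (⨾-cong ≈-refl (≈-sym (⊗-of-effect bra bra))) ⟩
  Ω                                               ∎

not-involutive : (notGate ⨾ notGate) ≈ id 1
not-involutive = begin
  (K ⨾ (cnot ⨾ B)) ⨾ (K ⨾ (cnot ⨾ B))   ≈⟨ ⨾-assoc _ _ _ ⟩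
  K ⨾ ((cnot ⨾ B) ⨾ (K ⨾ (cnot ⨾ B)))   ≈⟨ ⨾-cong ≈-refl (⨾-assoc _ _ _) ⟩
  K ⨾ (cnot ⨾ (B ⨾ (K ⨾ (cnot ⨾ B))))   ≈⟨ ⨾-cong ≈-refl (⨾-cong ≈-refl (⨾-assoc⁻¹ _ _ _)) ⟩
  K ⨾ (cnot ⨾ ((B ⨾ K) ⨾ (cnot ⨾ B)))   ≈⟨ ⨾-cong ≈-refl (⨾-assoc⁻¹ _ _ _) ⟩
  K ⨾ ((cnot ⨾ (B ⨾ K)) ⨾ (cnot ⨾ B))   ≈⟨ ⨾-assoc⁻¹ _ _ _ ⟩
  (K ⨾ (cnot ⨾ (B ⨾ K))) ⨾ (cnot ⨾ B)   ≈⟨ ⨾-cong (≈-sym (ax ax4)) ≈-refl ⟩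
  (K ⨾ cnot) ⨾ (cnot ⨾ B)               ≈⟨ ⨾-assoc _ _ _ ⟩
  K ⨾ (cnot ⨾ (cnot ⨾ B))               ≈⟨ ⨾-cong ≈-refl (⨾-assoc⁻¹ _ _ _) ⟩
  K ⨾ ((cnot ⨾ cnot) ⨾ B)               ≈⟨ ⨾-cong ≈-refl (≈-trans (⨾-cong (ax ax2) ≈-refl) (idˡ _)) ⟩
  K ⨾ B                                 ≈⟨ ≈-sym (interchange ket bra (id 1) (id 1)) ⟩
  (ket ⨾ bra) ⊗ (id 1 ⨾ id 1)           ≈⟨ ⊗-cong (ax ax7) (idˡ _) ⟩
  id 0 ⊗ id 1                           ≈⟨ ⊗-unitˡ _ ⟩
  id 1                                  ∎
  where
    K = ket ⊗ id 1
    B = bra ⊗ id 1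

ket0-not-bra : (ket0 ⨾ (notGate ⨾ bra)) ≈ id 0
ket0-not-bra = begin
  ket0 ⨾ (notGate ⨾ bra)            ≈⟨ ⨾-cong ket0-via-not ≈-refl ⟩
  (ket ⨾ notGate) ⨾ (notGate ⨾ bra) ≈⟨ ⨾-assoc _ _ _ ⟩
  ket ⨾ (notGate ⨾ (notGate ⨾ bra)) ≈⟨ ⨾-cong ≈-refl (⨾-assoc⁻¹ _ _ _) ⟩
  ket ⨾ ((notGate ⨾ notGate) ⨾ bra) ≈⟨ ⨾-cong ≈-refl (≈-trans (⨾-cong not-involutive ≈-refl) (idˡ bra)) ⟩
  ket ⨾ bra                         ≈⟨ ax ax7 ⟩
  id 0                              ∎

cnot-bra-bra : (cnot ⨾ (bra ⊗ bra)) ≈ ((bra ⊗ id 1) ⨾ (notGate ⨾ bra))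
cnot-bra-bra = begin
  cnot ⨾ (bra ⊗ bra)                                   ≈⟨ ⨾-cong ≈-refl (⊗-of-effect bra bra) ⟩
  cnot ⨾ ((bra ⊗ id 1) ⨾ bra)                          ≈⟨ ⨾-assoc⁻¹ _ _ _ ⟩
  (cnot ⨾ (bra ⊗ id 1)) ⨾ bra                          ≈⟨ ⨾-cong (ax ax5) ≈-refl ⟩
  ((bra ⊗ id 1) ⨾ ((ket ⊗ id 1) ⨾ (cnot ⨾ (bra ⊗ id 1)))) ⨾ bra ≈⟨ ⨾-assoc _ _ _ ⟩
  (bra ⊗ id 1) ⨾ (notGate ⨾ bra)                       ∎

ket0-control-cnot : ((ket0 ⊗ id 1) ⨾ cnot) ≈ (ket0 ⊗ id 1)
ket0-control-cnot = begin
  (ket0 ⊗ id 1) ⨾ cnot                       ≈⟨ ⨾-cong unfold ≈-refl ⟩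
  (K3 ⨾ (C12₃ ⨾ (bra ⊗ id 2))) ⨾ cnot        ≈⟨ ⨾-assoc _ _ _ ⟩
  K3 ⨾ ((C12₃ ⨾ (bra ⊗ id 2)) ⨾ cnot)        ≈⟨ ⨾-cong ≈-refl (⨾-assoc _ _ _) ⟩
  K3 ⨾ (C12₃ ⨾ ((bra ⊗ id 2) ⨾ cnot))        ≈⟨ ⨾-cong ≈-refl (⨾-cong ≈-refl (≈-sym slide)) ⟩
  K3 ⨾ (C12₃ ⨾ (C23₃ ⨾ (bra ⊗ id 2)))        ≈⟨ ax ax8 ⟩
  K3 ⨾ (C12₃ ⨾ (bra ⊗ id 2))                 ≈⟨ ≈-sym unfold ⟩
  ket0 ⊗ id 1                                ∎
  where
    K3 : Tm 1 3
    K3 = ket ⊗ (ket ⊗ id 1)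

    unfold : (ket0 ⊗ id 1) ≈ (K3 ⨾ (C12₃ ⨾ (bra ⊗ id 2)))
    unfold = begin
      ket0 ⊗ id 1                                    ≈⟨ ⊗-cong ≈-refl (≈-sym (≈-trans (idˡ _) (idˡ _))) ⟩
      ket0 ⊗ (id 1 ⨾ (id 1 ⨾ id 1))                  ≈⟨ interchange₃ _ _ _ _ _ _ ⟩
      ((ket ⊗ ket) ⊗ id 1) ⨾ (C12₃ ⨾ ((bra ⊗ id 1) ⊗ id 1))
        ≈⟨ ⨾-cong (⊗-assoc ket ket (id 1))
                  (⨾-cong ≈-refl (≈-trans (⊗-assoc bra (id 1) (id 1)) (⊗-cong ≈-refl (⊗-id 1 1)))) ⟩
      K3 ⨾ (C12₃ ⨾ (bra ⊗ id 2))                     ∎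

    slide : (C23₃ ⨾ (bra ⊗ id 2)) ≈ ((bra ⊗ id 2) ⨾ cnot)
    slide = begin
      (id 1 ⊗ cnot) ⨾ (bra ⊗ id 2)    ≈⟨ ≈-sym (interchange (id 1) bra cnot (id 2)) ⟩
      (id 1 ⨾ bra) ⊗ (cnot ⨾ id 2)    ≈⟨ ⊗-cong (≈-trans (idˡ bra) (≈-sym (idʳ bra))) (≈-trans (idʳ cnot) (≈-sym (idˡ cnot))) ⟩
      (bra ⨾ id 0) ⊗ (id 2 ⨾ cnot)    ≈⟨ interchange bra (id 0) (id 2) cnot ⟩
      (bra ⊗ id 2) ⨾ (id 0 ⊗ cnot)    ≈⟨ ⨾-cong ≈-refl (⊗-unitˡ cnot) ⟩
      (bra ⊗ id 2) ⨾ cnot             ∎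

Ω-⊗-idem : (Ω ⊗ Ω) ≈ Ω
Ω-⊗-idem = begin
  Ω ⊗ Ω                                         ≈⟨ ⊗-cong (≈-sym ket0-bra) (≈-sym ket0-bra) ⟩
  (ket0 ⨾ bra) ⊗ (ket0 ⨾ bra)                   ≈⟨ interchange ket0 bra ket0 bra ⟩
  (ket0 ⊗ ket0) ⨾ (bra ⊗ bra)                   ≈⟨ ⨾-cong (≈-sym cnot-fixes) ≈-refl ⟩
  ((ket0 ⊗ ket0) ⨾ cnot) ⨾ (bra ⊗ bra)          ≈⟨ ⨾-assoc _ _ _ ⟩
  (ket0 ⊗ ket0) ⨾ (cnot ⨾ (bra ⊗ bra))          ≈⟨ ⨾-cong ≈-refl cnot-bra-bra ⟩
  (ket0 ⊗ ket0) ⨾ ((bra ⊗ id 1) ⨾ (notGate ⨾ bra)) ≈⟨ ⨾-assoc⁻¹ _ _ _ ⟩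
  ((ket0 ⊗ ket0) ⨾ (bra ⊗ id 1)) ⨾ (notGate ⨾ bra) ≈⟨ ⨾-cong (≈-sym (interchange ket0 bra ket0 (id 1))) (≈-sym (⊗-unitˡ _)) ⟩
  ((ket0 ⨾ bra) ⊗ (ket0 ⨾ id 1)) ⨾ (id 0 ⊗ (notGate ⨾ bra)) ≈⟨ ≈-sym (interchange _ _ _ _) ⟩
  ((ket0 ⨾ bra) ⨾ id 0) ⊗ ((ket0 ⨾ id 1) ⨾ (notGate ⨾ bra))
    ≈⟨ ⊗-cong (≈-trans (idʳ _) ket0-bra) (≈-trans (⨾-cong (idʳ ket0) ≈-refl) ket0-not-bra) ⟩
  Ω ⊗ id 0                                      ≈⟨ ⊗-unitʳ Ω ⟩
  Ω                                             ∎
  where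
    cnot-fixes : ((ket0 ⊗ ket0) ⨾ cnot) ≈ (ket0 ⊗ ket0)
    cnot-fixes = begin
      (ket0 ⊗ ket0) ⨾ cnot              ≈⟨ ⨾-cong (⊗-of-state ket0 ket0) ≈-refl ⟩
      (ket0 ⨾ (ket0 ⊗ id 1)) ⨾ cnot     ≈⟨ ⨾-assoc _ _ _ ⟩
      ket0 ⨾ ((ket0 ⊗ id 1) ⨾ cnot)     ≈⟨ ⨾-cong ≈-refl ket0-control-cnot ⟩
      ket0 ⨾ (ket0 ⊗ id 1)              ≈⟨ ≈-sym (⊗-of-state ket0 ket0) ⟩
      ket0 ⊗ ket0                       ∎

Ω-⨾-idem : (Ω ⨾ Ω) ≈ Ω
Ω-⨾-idem = ≈-trans (≈-sym (scalar-⊗-state Ω Ω)) Ω-⊗-idem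

-- ax11 trades the idle wire next to Ω for ⟨1| before it and |1⟩ after it.
Ω⊗id1-factors : (Ω ⊗ id 1) ≈ (bra ⨾ (Ω ⨾ ket))
Ω⊗id1-factors = begin
  Ω ⊗ id 1                                                ≈⟨ ⊗-cong ≈-refl (≈-sym (≈-trans (idˡ _) (idˡ _))) ⟩
  Ω ⊗ (id 1 ⨾ (id 1 ⨾ id 1))                              ≈⟨ interchange₃ _ _ _ _ _ _ ⟩
  ((ket ⊗ ket) ⊗ id 1) ⨾ (C12₃ ⨾ ((bra ⊗ bra) ⊗ id 1))     ≈⟨ ⨾-cong (⊗-assoc ket ket (id 1)) (⨾-cong ≈-refl (⊗-assoc bra bra (id 1))) ⟩
  (ket ⊗ ket ⊗ id 1) ⨾ (C12₃ ⨾ (bra ⊗ bra ⊗ id 1))        ≈⟨ ax ax11 ⟩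
  (ket ⊗ ket ⊗ bra) ⨾ (cnot ⨾ (bra ⊗ bra ⊗ ket))          ≈⟨ ⨾-cong kets-bra (⨾-cong ≈-refl bras-ket) ⟩
  (bra ⨾ (ket ⊗ ket)) ⨾ (cnot ⨾ ((bra ⊗ bra) ⨾ ket))      ≈⟨ ⨾-assoc _ _ _ ⟩
  bra ⨾ ((ket ⊗ ket) ⨾ (cnot ⨾ ((bra ⊗ bra) ⨾ ket)))      ≈⟨ ⨾-cong ≈-refl (⨾-cong ≈-refl (⨾-assoc⁻¹ _ _ _)) ⟩
  bra ⨾ ((ket ⊗ ket) ⨾ ((cnot ⨾ (bra ⊗ bra)) ⨾ ket))      ≈⟨ ⨾-cong ≈-refl (⨾-assoc⁻¹ _ _ _) ⟩
  bra ⨾ (Ω ⨾ ket)                                         ∎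
  where
    kets-bra : (ket ⊗ ket ⊗ bra) ≈ (bra ⨾ (ket ⊗ ket))
    kets-bra = ≈-trans (≈-sym (⊗-assoc ket ket bra))
               (≈-trans (⊗-of-state (ket ⊗ ket) bra) (⨾-cong ≈-refl (⊗-unitʳ _)))

    bras-ket : (bra ⊗ bra ⊗ ket) ≈ ((bra ⊗ bra) ⨾ ket)
    bras-ket = ≈-trans (≈-sym (⊗-assoc bra bra ket))
               (≈-trans (⊗-of-effect (bra ⊗ bra) ket) (⨾-cong (⊗-unitʳ _) ≈-refl))

bras-+ : (a c : ℕ) → bras (a + c) ≈ (bras a ⊗ bras c)
bras-+ zero    c = ≈-sym (⊗-unitˡ (bras c))
bras-+ (suc a) c = ≈-trans (⊗-cong ≈-refl (bras-+ a c)) (≈-sym (⊗-assoc bra (bras a) (bras c)))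

kets-+ : (a c : ℕ) → kets (a + c) ≈ (kets a ⊗ kets c)
kets-+ zero    c = ≈-sym (⊗-unitˡ (kets c))
kets-+ (suc a) c = ≈-trans (⊗-cong ≈-refl (kets-+ a c)) (≈-sym (⊗-assoc ket (kets a) (kets c)))

kets⨾bras : (a : ℕ) → (kets a ⨾ bras a) ≈ id 0
kets⨾bras zero    = idˡ _
kets⨾bras (suc a) = ≈-trans (≈-sym (interchange ket bra (kets a) (bras a)))
                    (≈-trans (⊗-cong (ax ax7) (kets⨾bras a)) (⊗-unitˡ (id 0)))

sw⨾bras : (a b : ℕ) → (sw a b ⨾ bras (b + a)) ≈ bras (a + b)
sw⨾bras a b = begin
  sw a b ⨾ bras (b + a)        ≈⟨ ⨾-cong ≈-refl (bras-+ b a) ⟩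
  sw a b ⨾ (bras b ⊗ bras a)   ≈⟨ ≈-sym (sw-nat (bras a) (bras b)) ⟩
  (bras a ⊗ bras b) ⨾ sw 0 0   ≈⟨ ⨾-cong ≈-refl (sw-unitˡ 0) ⟩
  (bras a ⊗ bras b) ⨾ id 0     ≈⟨ idʳ _ ⟩
  bras a ⊗ bras b              ≈⟨ ≈-sym (bras-+ a b) ⟩
  bras (a + b)                 ∎

Ω[]-⊗ : (a b c d : ℕ) → (Ω[ a , b ] ⊗ Ω[ c , d ]) ≈ Ω[ a + c , b + d ]
Ω[]-⊗ a b c d = ≈-trans (interchange₃ (bras a) Ω (kets b) (bras c) Ω (kets d))
  (⨾-cong (≈-sym (bras-+ a c)) (⨾-cong Ω-⊗-idem (≈-sym (kets-+ b d))))

Ω[]-⨾ : (a b c : ℕ) → (Ω[ a , b ] ⨾ Ω[ b , c ]) ≈ Ω[ a , c ]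
Ω[]-⨾ a b c = begin
  (bras a ⨾ (Ω ⨾ kets b)) ⨾ (bras b ⨾ (Ω ⨾ kets c))   ≈⟨ ⨾-assoc _ _ _ ⟩
  bras a ⨾ ((Ω ⨾ kets b) ⨾ (bras b ⨾ (Ω ⨾ kets c)))   ≈⟨ ⨾-cong ≈-refl (⨾-assoc _ _ _) ⟩
  bras a ⨾ (Ω ⨾ (kets b ⨾ (bras b ⨾ (Ω ⨾ kets c))))   ≈⟨ ⨾-cong ≈-refl (⨾-cong ≈-refl (⨾-assoc⁻¹ _ _ _)) ⟩
  bras a ⨾ (Ω ⨾ ((kets b ⨾ bras b) ⨾ (Ω ⨾ kets c)))   ≈⟨ ⨾-cong ≈-refl (⨾-cong ≈-refl (≈-trans (⨾-cong (kets⨾bras b) ≈-refl) (idˡ _))) ⟩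
  bras a ⨾ (Ω ⨾ (Ω ⨾ kets c))                         ≈⟨ ⨾-cong ≈-refl (≈-trans (⨾-assoc⁻¹ _ _ _) (⨾-cong Ω-⨾-idem ≈-refl)) ⟩
  bras a ⨾ (Ω ⨾ kets c)                               ∎

bra0-Ω : ((notGate ⨾ bra) ⨾ Ω) ≈ (bra ⨾ Ω)
bra0-Ω = begin
  (notGate ⨾ bra) ⨾ Ω              ≈⟨ ≈-sym (scalar-⊗-effect Ω _) ⟩
  Ω ⊗ (notGate ⨾ bra)              ≈⟨ ⊗-of-effect Ω _ ⟩
  (Ω ⊗ id 1) ⨾ (notGate ⨾ bra)     ≈⟨ ⨾-cong Ω⊗id1-factors ≈-refl ⟩
  (bra ⨾ (Ω ⨾ ket)) ⨾ (notGate ⨾ bra) ≈⟨ ⨾-assoc _ _ _ ⟩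
  bra ⨾ ((Ω ⨾ ket) ⨾ (notGate ⨾ bra)) ≈⟨ ⨾-cong ≈-refl (⨾-assoc _ _ _) ⟩
  bra ⨾ (Ω ⨾ (ket ⨾ (notGate ⨾ bra))) ≈⟨ ⨾-cong ≈-refl (⨾-cong ≈-refl ket-not-bra) ⟩
  bra ⨾ (Ω ⨾ Ω)                    ≈⟨ ⨾-cong ≈-refl Ω-⨾-idem ⟩
  bra ⨾ Ω                          ∎
  where
    ket-not-bra : (ket ⨾ (notGate ⨾ bra)) ≈ Ω
    ket-not-bra = ≈-trans (⨾-assoc⁻¹ _ _ _)
                  (≈-trans (⨾-cong (≈-sym ket0-via-not) ≈-refl) ket0-bra)

cnot-bras-Ω : ((cnot ⨾ bras 2) ⨾ Ω) ≈ (bras 2 ⨾ Ω)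
cnot-bras-Ω = begin
  (cnot ⨾ bras 2) ⨾ Ω                       ≈⟨ ⨾-cong (⨾-cong ≈-refl bras2) ≈-refl ⟩
  (cnot ⨾ (bra ⊗ bra)) ⨾ Ω                  ≈⟨ ⨾-cong cnot-bra-bra ≈-refl ⟩
  ((bra ⊗ id 1) ⨾ (notGate ⨾ bra)) ⨾ Ω      ≈⟨ ⨾-assoc _ _ _ ⟩
  (bra ⊗ id 1) ⨾ ((notGate ⨾ bra) ⨾ Ω)      ≈⟨ ⨾-cong ≈-refl bra0-Ω ⟩
  (bra ⊗ id 1) ⨾ (bra ⨾ Ω)                  ≈⟨ ⨾-assoc⁻¹ _ _ _ ⟩
  ((bra ⊗ id 1) ⨾ bra) ⨾ Ω                  ≈⟨ ⨾-cong (≈-trans (≈-sym (⊗-of-effect bra bra)) (≈-sym bras2)) ≈-refl ⟩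
  bras 2 ⨾ Ω                                ∎
  where
    bras2 : bras 2 ≈ (bra ⊗ bra)
    bras2 = ⊗-cong ≈-refl (⊗-unitʳ bra)

Ω-absorbs-⊗ : ∀ {a b c d} (f : Tm a b) (g : Tm c d) →
              (Ω ⊗ f) ≈ Ω[ a , b ] → (Ω ⊗ g) ≈ Ω[ c , d ] →
              (Ω ⊗ (f ⊗ g)) ≈ Ω[ a + c , b + d ]
Ω-absorbs-⊗ {a} {b} {c} {d} f g absorbs-f absorbs-g = begin
  Ω ⊗ (f ⊗ g)              ≈⟨ ⊗-cong (≈-sym Ω-⊗-idem) ≈-refl ⟩
  (Ω ⊗ Ω) ⊗ (f ⊗ g)        ≈⟨ ⊗-assoc Ω Ω (f ⊗ g) ⟩
  Ω ⊗ (Ω ⊗ (f ⊗ g))        ≈⟨ ⊗-cong ≈-refl (≈-sym (⊗-assoc Ω f g)) ⟩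
  Ω ⊗ ((Ω ⊗ f) ⊗ g)        ≈⟨ ⊗-cong ≈-refl (⊗-cong (≈-sym (scalar-comm Ω f)) ≈-refl) ⟩
  Ω ⊗ ((f ⊗ Ω) ⊗ g)        ≈⟨ ⊗-cong ≈-refl (⊗-assoc f Ω g) ⟩
  Ω ⊗ (f ⊗ (Ω ⊗ g))        ≈⟨ ≈-sym (⊗-assoc Ω f (Ω ⊗ g)) ⟩
  (Ω ⊗ f) ⊗ (Ω ⊗ g)        ≈⟨ ⊗-cong absorbs-f absorbs-g ⟩
  Ω[ a , b ] ⊗ Ω[ c , d ]  ≈⟨ Ω[]-⊗ a b c d ⟩
  Ω[ a + c , b + d ]       ∎

Ω-absorbs-id : (a : ℕ) → (Ω ⊗ id a) ≈ Ω[ a , a ]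
Ω-absorbs-id zero    = ≈-trans (⊗-unitʳ Ω) (≈-sym (≈-trans (idˡ _) (idʳ _)))
Ω-absorbs-id (suc a) = ≈-trans (⊗-cong ≈-refl (≈-sym (⊗-id 1 a)))
  (Ω-absorbs-⊗ (id 1) (id a) absorbs-id1 (Ω-absorbs-id a))
  where
    absorbs-id1 : (Ω ⊗ id 1) ≈ Ω[ 1 , 1 ]
    absorbs-id1 = ≈-trans Ω⊗id1-factors
      (⨾-cong (≈-sym (⊗-unitʳ bra)) (⨾-cong ≈-refl (≈-sym (⊗-unitʳ ket))))

Ω-absorbs-via-bras : ∀ {a b} (g : Tm a b) →
  ((g ⨾ bras b) ⨾ Ω) ≈ (bras a ⨾ Ω) → (Ω ⊗ g) ≈ Ω[ a , b ]
Ω-absorbs-via-bras {a} {b} g slides = begin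
  Ω ⊗ g                                 ≈⟨ ⊗-of-state Ω g ⟩
  g ⨾ (Ω ⊗ id b)                        ≈⟨ ⨾-cong ≈-refl (Ω-absorbs-id b) ⟩
  g ⨾ (bras b ⨾ (Ω ⨾ kets b))           ≈⟨ ⨾-assoc⁻¹ _ _ _ ⟩
  (g ⨾ bras b) ⨾ (Ω ⨾ kets b)           ≈⟨ ⨾-assoc⁻¹ _ _ _ ⟩
  ((g ⨾ bras b) ⨾ Ω) ⨾ kets b           ≈⟨ ⨾-cong slides ≈-refl ⟩
  (bras a ⨾ Ω) ⨾ kets b                 ≈⟨ ⨾-assoc _ _ _ ⟩
  Ω[ a , b ]                            ∎

Ω-absorbs : ∀ {a b} (f : Tm a b) → (Ω ⊗ f) ≈ Ω[ a , b ]
Ω-absorbs (id a)  = Ω-absorbs-id a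
Ω-absorbs {a} {c} (_⨾_ {b = b} f g) = begin
  Ω ⊗ (f ⨾ g)              ≈⟨ ⊗-cong (≈-sym Ω-⨾-idem) ≈-refl ⟩
  (Ω ⨾ Ω) ⊗ (f ⨾ g)        ≈⟨ interchange Ω Ω f g ⟩
  (Ω ⊗ f) ⨾ (Ω ⊗ g)        ≈⟨ ⨾-cong (Ω-absorbs f) (Ω-absorbs g) ⟩
  Ω[ a , b ] ⨾ Ω[ b , c ]  ≈⟨ Ω[]-⨾ a b c ⟩
  Ω[ a , c ]               ∎
Ω-absorbs (f ⊗ g) = Ω-absorbs-⊗ f g (Ω-absorbs f) (Ω-absorbs g)
Ω-absorbs (sw a b) = Ω-absorbs-via-bras (sw a b) (⨾-cong (sw⨾bras a b) ≈-refl)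
Ω-absorbs cnot     = Ω-absorbs-via-bras cnot cnot-bras-Ω
Ω-absorbs ket = ≈-trans (scalar-⊗-state Ω ket) (≈-sym (≈-trans (idˡ _) (⨾-cong ≈-refl (⊗-unitʳ ket))))
Ω-absorbs bra = ≈-trans (scalar-⊗-effect Ω bra) (≈-sym (⨾-cong (⊗-unitʳ bra) (idʳ Ω)))

mainTheorem15 : (n m p : ℕ) →
    ((f : Tm n m) → f ≈ (f ⊗ Ω) → f ≈ Ω[ n , m ])
    × ((g : Tm m p) → (Ω[ n , m ] ⨾ g) ≈ Ω[ n , p ])
    × ((h : Tm p n) → (h ⨾ Ω[ n , m ]) ≈ Ω[ p , m ])
mainTheorem15 n m p = fixed-by-Ω , precomposed , postcomposed
  where
    Ω[n,m]-absorbs : Ω[ n , m ] ≈ (Ω ⊗ Ω[ n , m ])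
    Ω[n,m]-absorbs = ≈-sym (Ω-absorbs Ω[ n , m ])

    fixed-by-Ω : (f : Tm n m) → f ≈ (f ⊗ Ω) → f ≈ Ω[ n , m ]
    fixed-by-Ω f fixed = ≈-trans fixed (≈-trans (scalar-comm Ω f) (Ω-absorbs f))

    precomposed : (g : Tm m p) → (Ω[ n , m ] ⨾ g) ≈ Ω[ n , p ]
    precomposed g = ≈-trans (⨾-cong Ω[n,m]-absorbs ≈-refl)
                    (≈-trans (scalar-⨾ˡ Ω Ω[ n , m ] g) (Ω-absorbs _))

    postcomposed : (h : Tm p n) → (h ⨾ Ω[ n , m ]) ≈ Ω[ p , m ]
    postcomposed h = ≈-trans (⨾-cong ≈-refl Ω[n,m]-absorbs)
                     (≈-trans (scalar-⨾ʳ Ω h Ω[ n , m ]) (Ω-absorbs _))
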